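{- $CAN(3,15,2)\ge 15$.
   Context: A binary $t$-covering array of size $m$ and degree $n$ is an $m\times n$ matrix with entries in $\{0,1\}$ such that for any $t$ distinct columns, all $2^t$ binary vectors of length $t$ occur at least once as the restriction of some row to those columns. $CAN(t,n,2)$ denotes the minimum $m$ such that a binary $t$-covering array of size $m$ and degree $n$ exists. -}

module Defs where

open import Data.Nat using (ℕ)
open import Data.Bool using (Bool)
open import Data.Fin using (Fin)
open import Data.Product using (∃)
open import Relation.Binary.PropositionalEquality using (_≡_)
open import Function.Definitions using (Injective)

BinMatrix : ℕ → ℕ → Set
BinMatrix m n = Fin m → Fin n → Bool

-- A binary t-covering array of size m and degree n: for every choice of
-- t distinct columns (an injective map cols : Fin t → Fin n) and every
-- binary vector v of length t, some row restricted to those columns is v.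
IsCoveringArray : (t m n : ℕ) → BinMatrix m n → Set
IsCoveringArray t m n A =
  (cols : Fin t → Fin n) → Injective _≡_ _≡_ cols →
  (v : Fin t → Bool) →
  ∃ λ (r : Fin m) → (j : Fin t) → A r (cols j) ≡ v j

-- CAN(t,n,2) ≥ k  :  every binary t-covering array of degree n has size ≥ k
-- (i.e. the minimum size is at least k).
CAN≥ : (t n k : ℕ) → Set
CAN≥ t n k = (m : ℕ) (A : BinMatrix m n) → IsCoveringArray t m n A → k Data.Nat.≤ m

module Submission where

-- Suppose L is one with at most 14 rows.  For a column c, the rows of L
-- with a one (resp. a zero) in column c restrict to a binary 2-covering
-- array on the other 14 columns, the derived arrays of c.
--  (1) CAN(2,14,2) ≥ 7, so both derived arrays have exactly 7 rows.
--  (2) In a 7-row 2-covering array on 14 columns every column has weight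
--      3 or 4, any two columns differ in 2, 3, 4 or 5 rows, some four
--      columns pairwise differ in 2 or 5 rows ("extreme"), and no four
--      columns pairwise differ in 3 or 4 rows ("balanced").
--  (3) Counting shows that two columns d, e are never extreme in both
--      derived arrays of c: they differ in twice as many rows of L as e has
--      ones among the zero-rows of d, i.e. in 6 or 8 rows, not 4, 7 or 10.
-- By (2) and (3), four pairwise extreme columns of the zero-array of c are
-- pairwise balanced in its one-array, contradicting (2).
--
-- Facts (1) and (2) are statements about 14 pairwise qualitatively
-- independent binary words of length 6 or 7 (the columns, normalised to
-- begin with 0).  They are certified by evaluating an exhaustive clique
-- search whose soundness is proved first.

open import Defs

open import Algebra.Bundles using (CommutativeRing)
open import Data.Bool using (Bool; true; false; T; not; _∧_; _∨_; _xor_; if_then_else_)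
open import Data.Bool.ListAction using (any; all)
open import Data.Bool.Properties
  using (_≟_; T-∧; T-∨; T-≡; T-not-≡; xor-identityʳ; xor-comm; xor-same; xor-assoc; xor-∧-commutativeRing)
open import Data.Empty using (⊥; ⊥-elim)
open import Data.Fin using (Fin; zero; suc; punchIn; punchOut)
import Data.Fin.Properties as Fin
open import Data.List
  using (List; []; _∷_; length; lookup; filterᵇ; map; _++_; zipWith; replicate; tabulate)
open import Data.List.Membership.Propositional using (_∈_; find; lose)
open import Data.List.Membership.Propositional.Properties
  using (∈-filter⁺; ∈-filter⁻; ∈-map⁺; ∈-++⁺ˡ; ∈-++⁺ʳ)
open import Data.List.Properties using (≡-dec; length-map; length-++; length-replicate; length-tabulate)
open import Data.List.Relation.Binary.Subset.Propositional using (_⊆_)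
open import Data.List.Relation.Unary.All using (All)
import Data.List.Relation.Unary.All as All
open import Data.List.Relation.Unary.All.Properties using (all⁺)
open import Data.List.Relation.Unary.Any using (Any; here; there; index)
import Data.List.Relation.Unary.Any as Any
import Data.List.Relation.Unary.Any.Properties as Any
open import Data.Nat using (ℕ; zero; suc; _+_; _∸_; _≤_; _<_; _<ᵇ_; _≡ᵇ_)
open import Data.Nat.Properties
  using (<ᵇ⇒<; <⇒≱; ≮⇒≥; ≤-pred; ≤-antisym; ≤-trans; +-suc; +-comm; +-cancelˡ-≡; +-cancelʳ-≡;
         +-cancelˡ-≤; +-cancelʳ-≤; +-monoˡ-≤; +-monoʳ-≤; ≡ᵇ⇒≡; ≡⇒≡ᵇ; m+[n∸m]≡n; suc-injective)
open import Data.Product using (∃; _×_; _,_; proj₁; proj₂)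
open import Data.Sum using (_⊎_; inj₁; inj₂)
import Data.Sum as Sum
open import Data.Unit using (tt)
open import Function using (_∘_; id; const)
open import Function.Bundles using (Equivalence)
open import Function.Definitions using (Injective)
open import Relation.Binary.Definitions using (DecidableEquality)
open import Relation.Binary.PropositionalEquality
open import Relation.Nullary using (yes; no; ¬_; does)
open import Relation.Nullary.Decidable using (T?; dec-true)
open import Algebra.Properties.CommutativeSemigroup
  (CommutativeRing.+-commutativeSemigroup xor-∧-commutativeRing) using (interchange)

T-true : ∀ {b} → b ≡ true → T b
T-true refl = tt

infixr 5 _∧-intro_
_∧-intro_ : ∀ {x y} → T x → T y → T (x ∧ y)
tx ∧-intro ty = Equivalence.from T-∧ (tx , ty)

∧-elim : ∀ {x y} → T (x ∧ y) → T x × T y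
∧-elim = Equivalence.to T-∧

T-not : ∀ {x} → T (not x) → ¬ T x
T-not {false} _ ()

T-implies : ∀ {x y} → T (not x ∨ y) → T x → T y
T-implies {true} ty _ = ty

module CliqueSearch {V : Set} (_≟_ : DecidableEquality V)
  (adj : V → V → Bool) (adj-irrefl : ∀ v → ¬ T (adj v v)) (P : List V → Bool)
  where

  IsClique : ∀ {k} → (Fin k → V) → Set
  IsClique f = ∀ i j → i ≢ j → T (adj (f i) (f j))

  -- `everyClique k cand acc` succeeds when P holds for acc extended by any
  -- k-clique drawn from cand.
  everyClique : ℕ → List V → List V → Bool
  everyClique zero    cand       acc = P acc
  everyClique (suc k) []         acc = true
  everyClique (suc k) (v ∷ cand) acc =
    if length (v ∷ cand) <ᵇ suc k then true
    else everyClique k (filterᵇ (adj v) cand) (v ∷ acc) ∧ everyClique (suc k) cand acc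

  Listing : ∀ {k} → List V → (Fin k → V) → Set
  Listing acc f = ∃ λ xs → T (P xs) × acc ⊆ xs × (∀ i → f i ∈ xs)
                          × (∀ {x} → x ∈ xs → x ∈ acc ⊎ ∃ λ i → f i ≡ x)

  clique-injective : ∀ {k} {f : Fin k → V} → IsClique f → Injective _≡_ _≡_ f
  clique-injective {f = f} clique {i} {j} fi≡fj with i Fin.≟ j
  ... | yes i≡j = i≡j
  ... | no  i≢j = ⊥-elim (adj-irrefl (f j) (subst (λ x → T (adj x (f j))) fi≡fj (clique i j i≢j)))

  clique-fits : ∀ {k cand} {f : Fin k → V} → IsClique f → (∀ i → f i ∈ cand) → k ≤ length cand
  clique-fits {cand = cand} {f} clique mem = ≮⇒≥ λ short →
    let i , j , i<j , same = Fin.pigeonhole short (index ∘ mem) in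
    Fin.<⇒≢ i<j (clique-injective clique (begin
      f i                          ≡⟨ Any.lookup-index (mem i) ⟩
      lookup cand (index (mem i))  ≡⟨ cong (lookup cand) same ⟩
      lookup cand (index (mem j))  ≡⟨ Any.lookup-index (mem j) ⟨
      f j                          ∎))
    where open ≡-Reasoning

  take-vertex : ∀ {k v cand} {f : Fin (suc k) → V} → IsClique f → (∀ i → f i ∈ v ∷ cand) →
                ∀ {i₀} → f i₀ ≡ v → ∀ j → f (punchIn i₀ j) ∈ filterᵇ (adj v) cand
  take-vertex {f = f} clique mem {i₀} refl j with mem (punchIn i₀ j)
  ... | here same = ⊥-elim (Fin.punchInᵢ≢i i₀ j (clique-injective clique same))
  ... | there m   =
    ∈-filter⁺ (T? ∘ adj (f i₀)) m (clique i₀ (punchIn i₀ j) (Fin.punchInᵢ≢i i₀ j ∘ sym))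

  skip-vertex : ∀ {k v cand} {f : Fin k → V} → (∀ i → f i ∈ v ∷ cand) → (∀ i → f i ≢ v) →
                ∀ i → f i ∈ cand
  skip-vertex mem v∉f i with mem i
  ... | here fi≡v = ⊥-elim (v∉f i fi≡v)
  ... | there m   = m

  listing-insert : ∀ {k v acc} {f : Fin (suc k) → V} {i₀} → f i₀ ≡ v →
                   Listing (v ∷ acc) (f ∘ punchIn i₀) → Listing acc f
  listing-insert {v = v} {acc} {f} {i₀} fi₀≡v (xs , Pxs , v∷acc⊆xs , rest∈xs , xs⊆) =
    xs , Pxs , v∷acc⊆xs ∘ there , f∈xs , back
    where
    f∈xs : ∀ i → f i ∈ xs
    f∈xs i with i₀ Fin.≟ i
    ... | yes refl = subst (_∈ xs) (sym fi₀≡v) (v∷acc⊆xs (here refl))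
    ... | no  i₀≢i = subst (λ j → f j ∈ xs) (Fin.punchIn-punchOut i₀≢i) (rest∈xs (punchOut i₀≢i))
    back : ∀ {x} → x ∈ xs → x ∈ acc ⊎ ∃ λ i → f i ≡ x
    back x∈xs with xs⊆ x∈xs
    ... | inj₁ (here x≡v)  = inj₂ (i₀ , trans fi₀≡v (sym x≡v))
    ... | inj₁ (there x∈acc) = inj₁ x∈acc
    ... | inj₂ (j , same)  = inj₂ (punchIn i₀ j , same)

  Sound : ℕ → List V → Set
  Sound k cand = ∀ acc → T (everyClique k cand acc) →
                 (f : Fin k → V) → IsClique f → (∀ i → f i ∈ cand) → Listing acc f

  sound-step : ∀ {k v cand} → Sound k (filterᵇ (adj v) cand) → Sound (suc k) cand →
               Sound (suc k) (v ∷ cand)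
  sound-step {k} {v} {cand} takeSound skipSound acc ok f clique mem
    with length (v ∷ cand) <ᵇ suc k in short
  ... | true  = ⊥-elim (<⇒≱ (<ᵇ⇒< _ _ (subst T (sym short) _)) (clique-fits clique mem))
  ... | false with ∧-elim ok | Fin.any? (λ i → f i ≟ v)
  ...   | okTake , _ | yes (i₀ , fi₀≡v) =
          listing-insert fi₀≡v (takeSound (v ∷ acc) okTake (f ∘ punchIn i₀)
            (λ a b a≢b → clique _ _ (a≢b ∘ Fin.punchIn-injective i₀ a b))
            (take-vertex clique mem fi₀≡v))
  ...   | _ , okSkip | no v∉f =
          skipSound acc okSkip f clique (skip-vertex mem (λ i e → v∉f (i , e)))

  everyClique-sound : ∀ k cand → Sound k cand
  everyClique-sound zero    cand       acc ok f _ _   = acc , ok , id , (λ ()) , inj₁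
  everyClique-sound (suc k) []         acc _  f _ mem with mem Fin.zero
  ... | ()
  everyClique-sound (suc k) (v ∷ cand) =
    sound-step (everyClique-sound k (filterᵇ (adj v) cand)) (everyClique-sound (suc k) cand)

  SearchSucceeds : ℕ → List V → Set
  SearchSucceeds k cand = everyClique k cand [] ≡ true

  clique-listing : ∀ {k cand} → SearchSucceeds k cand →
                   (f : Fin k → V) → IsClique f → (∀ i → f i ∈ cand) →
                   ∃ λ xs → T (P xs) × (∀ i → f i ∈ xs) × (∀ {x} → x ∈ xs → ∃ λ i → f i ≡ x)
  clique-listing {k} {cand} ok f clique mem with everyClique-sound k cand [] (T-true ok) f clique mem
  ... | xs , Pxs , _ , f∈xs , xs⊆ = xs , Pxs , f∈xs , members
    where
    members : ∀ {x} → x ∈ xs → ∃ λ i → f i ≡ x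
    members x∈xs with xs⊆ x∈xs
    ... | inj₂ found = found

count : {A : Set} → (A → Bool) → List A → ℕ
count p xs = length (filterᵇ p xs)

count-cong : {A : Set} {p q : A → Bool} (xs : List A) →
             (∀ {x} → x ∈ xs → p x ≡ q x) → count p xs ≡ count q xs
count-cong []       agree = refl
count-cong {p = p} {q} (x ∷ xs) agree with p x | q x | agree (here refl)
... | true  | true  | refl = cong suc (count-cong xs (agree ∘ there))
... | false | false | refl = count-cong xs (agree ∘ there)

count-none : {A : Set} (xs : List A) → count (const false) xs ≡ 0
count-none []       = refl
count-none (x ∷ xs) = count-none xs

length-split : {A : Set} (q : A → Bool) (xs : List A) →
               length xs ≡ count q xs + count (not ∘ q) xs
length-split q []       = refl
length-split q (x ∷ xs) with q x
... | true  = cong suc (length-split q xs)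
... | false = trans (cong suc (length-split q xs)) (sym (+-suc _ _))

count-split : {A : Set} (p q : A → Bool) (xs : List A) →
              count p xs ≡ count p (filterᵇ q xs) + count p (filterᵇ (not ∘ q) xs)
count-split p q []       = refl
count-split p q (x ∷ xs) with q x
... | true  with p x
...   | true  = cong suc (count-split p q xs)
...   | false = count-split p q xs
count-split p q (x ∷ xs) | false with p x
...   | true  = trans (cong suc (count-split p q xs)) (sym (+-suc _ _))
...   | false = count-split p q xs

count-complement : {A : Set} (p : A → Bool) (xs : List A) →
                   count (not ∘ p) xs + count p xs ≡ length xs
count-complement p xs = trans (+-comm (count (not ∘ p) xs) _) (sym (length-split p xs))

EqUpToComplement : ℕ → ℕ → ℕ → Set
EqUpToComplement n a b = a ≡ b ⊎ a + b ≡ n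

count-xor : {A : Set} (p : A → Bool) (s : Bool) (xs : List A) →
            EqUpToComplement (length xs) (count (λ x → p x xor s) xs) (count p xs)
count-xor p false xs = inj₁ (count-cong xs (λ {x} _ → xor-identityʳ (p x)))
count-xor p true  xs = inj₂ (trans (cong (_+ count p xs) (count-cong xs (λ {x} _ → xor-comm (p x) true)))
                                   (count-complement p xs))

any-filter : {A : Set} {P : A → Set} (q : A → Bool) (xs : List A) →
             Any (λ x → P x × T (q x)) xs → Any P (filterᵇ q xs)
any-filter q xs found with find found
... | x , x∈xs , Px , qx = lose (∈-filter⁺ (T? ∘ q) x∈xs qx) Px

Quad : Set → Set
Quad A = A × A × A × A

Pairwise4 : {A : Set} → (A → A → Set) → Quad A → Set
Pairwise4 _~_ (a , b , c , d) = a ~ b × a ~ c × a ~ d × b ~ c × b ~ d × c ~ d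

pairwise4-map : {A : Set} {_~_ _≈_ : A → A → Set} → (∀ {x y} → x ~ y → x ≈ y) →
                ∀ q → Pairwise4 _~_ q → Pairwise4 _≈_ q
pairwise4-map f _ (ab , ac , ad , bc , bd , cd) = f ab , f ac , f ad , f bc , f bd , f cd

K4 : {A : Set} → (A → A → Bool) → List A → Set
K4 R xs = ∃ λ ((a , b , c , d) : Quad _) → (a ∈ xs × b ∈ xs × c ∈ xs × d ∈ xs)
                                          × Pairwise4 (λ x y → T (R x y)) (a , b , c , d)

hasK4 : {A : Set} → (A → A → Bool) → List A → Bool
hasK4 R xs = any (λ a → any (λ b → R a b ∧ any (λ c → R a c ∧ R b c ∧
                  any (λ d → R a d ∧ R b d ∧ R c d) xs) xs) xs) xs

hasK4-sound : {A : Set} (R : A → A → Bool) (xs : List A) → T (hasK4 R xs) → K4 R xs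
hasK4-sound R xs found =
  let a , a∈ , foundB    = find (Any.any⁻ _ xs found)
      b , b∈ , Rab∧C     = find (Any.any⁻ _ xs foundB)
      Rab , foundC       = ∧-elim Rab∧C
      c , c∈ , Rac∧Rbc∧D = find (Any.any⁻ _ xs foundC)
      Rac , Rbc∧D        = ∧-elim Rac∧Rbc∧D
      Rbc , foundD       = ∧-elim Rbc∧D
      d , d∈ , Rad∧Rbd∧Rcd = find (Any.any⁻ _ xs foundD)
      Rad , Rbd∧Rcd      = ∧-elim Rad∧Rbd∧Rcd
      Rbd , Rcd          = ∧-elim Rbd∧Rcd
  in (a , b , c , d) , (a∈ , b∈ , c∈ , d∈) , (Rab , Rac , Rad , Rbc , Rbd , Rcd)

hasK4-complete : {A : Set} (R : A → A → Bool) (xs : List A) → K4 R xs → T (hasK4 R xs)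
hasK4-complete R xs ((a , b , c , d) , (a∈ , b∈ , c∈ , d∈) , (Rab , Rac , Rad , Rbc , Rbd , Rcd)) =
  Any.any⁺ _ (lose a∈ (Any.any⁺ _ (lose b∈ (Rab ∧-intro Any.any⁺ _ (lose c∈ (Rac ∧-intro Rbc ∧-intro
    Any.any⁺ _ (lose d∈ (Rad ∧-intro Rbd ∧-intro Rcd))))))))

K4-pullback : {I A : Set} {R : A → A → Bool} {xs : List A} (f : I → A) →
              (∀ {x} → x ∈ xs → ∃ λ i → f i ≡ x) → K4 R xs →
              ∃ λ q → Pairwise4 (λ i j → T (R (f i) (f j))) q
K4-pullback f preimage ((a , b , c , d) , (a∈ , b∈ , c∈ , d∈) , pairwise)
  with preimage a∈ | preimage b∈ | preimage c∈ | preimage d∈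
... | i , refl | j , refl | k , refl | l , refl = (i , j , k , l) , pairwise

K4-image : {I A : Set} {R : A → A → Bool} {xs : List A} (f : I → A) →
           (∀ i → f i ∈ xs) → ∀ q → Pairwise4 (λ i j → T (R (f i) (f j))) q → K4 R xs
K4-image f f∈xs (i , j , k , l) pairwise =
  (f i , f j , f k , f l) , (f∈xs i , f∈xs j , f∈xs k , f∈xs l) , pairwise

Word : Set
Word = List Bool

words : ℕ → List Word
words zero    = [] ∷ []
words (suc n) = map (false ∷_) (words n) ++ map (true ∷_) (words n)

∈-words : (x : Word) → x ∈ words (length x)
∈-words []          = here refl
∈-words (false ∷ x) = ∈-++⁺ˡ (∈-map⁺ (false ∷_) (∈-words x))
∈-words (true ∷ x)  = ∈-++⁺ʳ (map (false ∷_) (words (length x))) (∈-map⁺ (true ∷_) (∈-words x))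

normalWords : ℕ → List Word
normalWords n = map (false ∷_) (words n)

∈-normalWords : (x : Word) → (false ∷ x) ∈ normalWords (length x)
∈-normalWords x = ∈-map⁺ (false ∷_) (∈-words x)

occurs : Bool → Bool → Word → Word → Bool
occurs a b (u ∷ x) (v ∷ y) = (does (u ≟ a) ∧ does (v ≟ b)) ∨ occurs a b x y
occurs a b _       _       = false

independent : Word → Word → Bool
independent x y = occurs true true x y ∧ occurs true false x y ∧ occurs false true x y ∧ occurs false false x y

independent-intro : ∀ {x y} → (∀ a b → T (occurs a b x y)) → T (independent x y)
independent-intro occ = occ true true ∧-intro occ true false ∧-intro occ false true ∧-intro occ false false

-- A word is not independent of itself: the pair (1,0) never occurs.
independent-irrefl : ∀ x → ¬ T (independent x x)
independent-irrefl x indep =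
  no-10 x (proj₁ (∧-elim (proj₂ (∧-elim {occurs true true x x} indep))))
  where
  no-10 : ∀ x → ¬ T (occurs true false x x)
  no-10 (true ∷ x)  = no-10 x
  no-10 (false ∷ x) = no-10 x

occurs-map : {A : Set} (g h : A → Bool) (xs : List A) {a b : Bool} →
             Any (λ x → g x ≡ a × h x ≡ b) xs → T (occurs a b (map g xs) (map h xs))
occurs-map g h (x ∷ xs) (here (refl , refl)) =
  Equivalence.from T-∨ (inj₁ (T-true (dec-true (g x ≟ g x) refl) ∧-intro T-true (dec-true (h x ≟ h x) refl)))
occurs-map g h (x ∷ xs) (there found) = Equivalence.from T-∨ (inj₂ (occurs-map g h xs found))

weight : Word → ℕ
weight = count id

distance : Word → Word → ℕ
distance x y = weight (zipWith _xor_ x y)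

weight-map : {A : Set} (g : A → Bool) (xs : List A) → weight (map g xs) ≡ count g xs
weight-map g []       = refl
weight-map g (x ∷ xs) with g x
... | true  = cong suc (weight-map g xs)
... | false = weight-map g xs

distance-map : {A : Set} (g h : A → Bool) (xs : List A) →
               distance (map g xs) (map h xs) ≡ count (λ x → g x xor h x) xs
distance-map g h xs = trans (cong weight (zipWith-map-diag xs)) (weight-map _ xs)
  where
  zipWith-map-diag : ∀ xs → zipWith _xor_ (map g xs) (map h xs) ≡ map (λ x → g x xor h x) xs
  zipWith-map-diag []       = refl
  zipWith-map-diag (x ∷ xs) = cong (_ ∷_) (zipWith-map-diag xs)

OneOf : ℕ → ℕ → ℕ → Set
OneOf a b n = n ≡ a ⊎ n ≡ b

oneOf? : ℕ → ℕ → ℕ → Bool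
oneOf? a b n = (n ≡ᵇ a) ∨ (n ≡ᵇ b)

oneOf-sound : ∀ {a b} n → T (oneOf? a b n) → OneOf a b n
oneOf-sound {a} {b} n = Sum.map (≡ᵇ⇒≡ n a) (≡ᵇ⇒≡ n b) ∘ Equivalence.to T-∨

oneOf-complete : ∀ {a b} n → OneOf a b n → T (oneOf? a b n)
oneOf-complete {a} {b} n = Equivalence.from T-∨ ∘ Sum.map (≡⇒≡ᵇ n a) (≡⇒≡ᵇ n b)

oneOf-complement : ∀ {a b x y} → x + y ≡ a + b → OneOf a b x → OneOf a b y
oneOf-complement {a} {b} {y = y} sum (inj₁ refl) = inj₂ (+-cancelˡ-≡ a y b sum)
oneOf-complement {a} {b} {y = y} sum (inj₂ refl) = inj₁ (+-cancelˡ-≡ b y a (trans sum (+-comm a b)))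

oneOf-transfer : ∀ {a b x y} → EqUpToComplement (a + b) x y → OneOf a b x → OneOf a b y
oneOf-transfer (inj₁ refl) = id
oneOf-transfer (inj₂ sum)  = oneOf-complement sum

oneOf-transfer⁻ : ∀ {a b x y} → EqUpToComplement (a + b) x y → OneOf a b y → OneOf a b x
oneOf-transfer⁻ (inj₁ refl)          = id
oneOf-transfer⁻ {x = x} {y} (inj₂ sum) = oneOf-complement (trans (+-comm y x) sum)

Balanced Extreme : ℕ → Set
Balanced = OneOf 3 4
Extreme  = OneOf 2 5

extreme+extreme≢balanced+balanced : ∀ {x y w} → Extreme x → Extreme y → Balanced w → x + y ≢ w + w
extreme+extreme≢balanced+balanced (inj₁ refl) (inj₁ refl) (inj₁ refl) ()
extreme+extreme≢balanced+balanced (inj₁ refl) (inj₁ refl) (inj₂ refl) ()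
extreme+extreme≢balanced+balanced (inj₁ refl) (inj₂ refl) (inj₁ refl) ()
extreme+extreme≢balanced+balanced (inj₁ refl) (inj₂ refl) (inj₂ refl) ()
extreme+extreme≢balanced+balanced (inj₂ refl) (inj₁ refl) (inj₁ refl) ()
extreme+extreme≢balanced+balanced (inj₂ refl) (inj₁ refl) (inj₂ refl) ()
extreme+extreme≢balanced+balanced (inj₂ refl) (inj₂ refl) (inj₁ refl) ()
extreme+extreme≢balanced+balanced (inj₂ refl) (inj₂ refl) (inj₂ refl) ()

extremePair balancedPair : Word → Word → Bool
extremePair  x y = oneOf? 2 5 (distance x y)
balancedPair x y = oneOf? 3 4 (distance x y)

admissible : Word → Word → Bool
admissible x y = not (independent x y) ∨ extremePair x y ∨ balancedPair x y

all-pairs-admissible : all (λ x → all (admissible x) (normalWords 6)) (normalWords 6) ≡ true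
all-pairs-admissible = refl

independent-distance : ∀ {x y} → x ∈ normalWords 6 → y ∈ normalWords 6 → T (independent x y) →
                       Extreme (distance x y) ⊎ Balanced (distance x y)
independent-distance {x} {y} x∈ y∈ indep =
  Sum.map (oneOf-sound _) (oneOf-sound _) (Equivalence.to T-∨ (T-implies {independent x y} x-y-admissible indep))
  where
  x-admissible : T (all (admissible x) (normalWords 6))
  x-admissible = All.lookup (all⁺ (λ x → all (admissible x) (normalWords 6)) (normalWords 6)
                                  (T-true all-pairs-admissible)) x∈
  x-y-admissible : T (admissible x y)
  x-y-admissible = All.lookup (all⁺ (admissible x) (normalWords 6) x-admissible) y∈

-- Fact (1): there are no 14 pairwise independent words of length 6 (it
-- suffices to consider words beginning with 0).  Checked by evaluation.
module Search6 = CliqueSearch {Word} (≡-dec _≟_) independent independent-irrefl (const false)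

no-14-independent-words-of-length-6 : Search6.SearchSucceeds 14 (normalWords 5)
no-14-independent-words-of-length-6 = refl

-- Fact (2): any 14 pairwise independent words of length 7 beginning with
-- 0 have weights 3 or 4, contain four words at pairwise extreme distance,
-- and do not contain four words at pairwise balanced distance.
shape : List Word → Bool
shape xs = all (oneOf? 3 4 ∘ weight) xs ∧ hasK4 extremePair xs ∧ not (hasK4 balancedPair xs)

module Search7 = CliqueSearch {Word} (≡-dec _≟_) independent independent-irrefl shape

shape-of-14-independent-words-of-length-7 : Search7.SearchSucceeds 14 (normalWords 6)
shape-of-14-independent-words-of-length-7 = refl

module TwoCovering {C : Set} (col : Fin 14 → C) where

  Row : Set
  Row = C → Bool

  Covers2 : List Row → Set
  Covers2 R = ∀ i j → i ≢ j → ∀ a b → Any (λ r → r (col i) ≡ a × r (col j) ≡ b) R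

  colWeight : Fin 14 → List Row → ℕ
  colWeight i = count (λ r → r (col i))

  colDist : Fin 14 → Fin 14 → List Row → ℕ
  colDist i j = count (λ r → r (col i) xor r (col j))

  ExtremeIn BalancedIn : List Row → Fin 14 → Fin 14 → Set
  ExtremeIn  R i j = Extreme (colDist i j R)
  BalancedIn R i j = Balanced (colDist i j R)

  extreme-distinct : ∀ R {i j} → ExtremeIn R i j → i ≢ j
  extreme-distinct R {i} extreme refl
    with subst Extreme (trans (count-cong R (λ {r} _ → xor-same (r (col i)))) (count-none R)) extreme
  ... | inj₁ ()
  ... | inj₂ ()

  -- Column i, complemented if r₀ has a one in column i; taking r₀ to be the
  -- first row makes every column begin with 0.
  normalColumn : Row → List Row → Fin 14 → Word
  normalColumn r₀ R i = map (λ r → r (col i) xor r₀ (col i)) R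

  normalColumn-normal : ∀ r₀ R i → normalColumn r₀ (r₀ ∷ R) i ∈ normalWords (length R)
  normalColumn-normal r₀ R i =
    subst₂ _∈_ begins-with-0 (cong normalWords (length-map _ R)) (∈-normalWords rest)
    where
    rest : Word
    rest = map (λ r → r (col i) xor r₀ (col i)) R
    begins-with-0 : false ∷ rest ≡ normalColumn r₀ (r₀ ∷ R) i
    begins-with-0 = cong (_∷ rest) (sym (xor-same (r₀ (col i))))

  -- Complementing a column preserves the pairs covered, so the normalised
  -- columns of a 2-covering array are pairwise independent.
  normalColumn-independent : ∀ {R} r₀ → Covers2 R →
    ∀ i j → i ≢ j → T (independent (normalColumn r₀ R i) (normalColumn r₀ R j))
  normalColumn-independent {R} r₀ covers i j i≢j =
    independent-intro {normalColumn r₀ R i} {normalColumn r₀ R j} λ a b →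
      occurs-map _ _ R (Any.map (λ (ea , eb) → unshift ea , unshift eb)
                                (covers i j i≢j (a xor r₀ (col i)) (b xor r₀ (col j))))
    where
    unshift : ∀ {u v s} → u ≡ v xor s → u xor s ≡ v
    unshift {v = v} {s} refl =
      trans (xor-assoc v s s) (trans (cong (v xor_) (xor-same s)) (xor-identityʳ v))

  weight-normalColumn : ∀ r₀ R i →
    EqUpToComplement (length R) (weight (normalColumn r₀ R i)) (colWeight i R)
  weight-normalColumn r₀ R i =
    subst (λ w → EqUpToComplement (length R) w (colWeight i R)) (sym (weight-map _ R))
          (count-xor (λ r → r (col i)) (r₀ (col i)) R)

  distance-normalColumn : ∀ r₀ R i j →
    EqUpToComplement (length R) (distance (normalColumn r₀ R i) (normalColumn r₀ R j)) (colDist i j R)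
  distance-normalColumn r₀ R i j =
    subst (λ d → EqUpToComplement (length R) d (colDist i j R)) (sym regroup)
          (count-xor (λ r → r (col i) xor r (col j)) (r₀ (col i) xor r₀ (col j)) R)
    where
    regroup : distance (normalColumn r₀ R i) (normalColumn r₀ R j)
            ≡ count (λ r → (r (col i) xor r (col j)) xor (r₀ (col i) xor r₀ (col j))) R
    regroup = trans (distance-map _ _ R)
                    (count-cong R (λ {r} _ → interchange (r (col i)) (r₀ (col i)) (r (col j)) (r₀ (col j))))

  -- Fact (1) in array form: CAN(2,14,2) ≥ 7.  A shorter array, padded to 6
  -- rows by repeating its first row, would give 14 pairwise independent
  -- normal words of length 6.
  covers2-length : ∀ R → Covers2 R → 7 ≤ length R
  covers2-length []       covers with covers zero (suc zero) (λ ()) true true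
  ... | ()
  covers2-length (r₀ ∷ R) covers = ≮⇒≥ λ short →
    let _ , impossible , _ =
          Search6.clique-listing {14} {normalWords 5} no-14-independent-words-of-length-6
            (normalColumn r₀ (r₀ ∷ padded))
            (normalColumn-independent r₀ (λ i j i≢j a b → Any.++⁺ˡ (covers i j i≢j a b)))
            (λ i → subst (λ n → normalColumn r₀ (r₀ ∷ padded) i ∈ normalWords n) (padded-length short)
                         (normalColumn-normal r₀ padded i))
    in impossible
    where
    padded : List Row
    padded = R ++ replicate (5 ∸ length R) r₀
    padded-length : length (r₀ ∷ R) < 7 → length padded ≡ 5
    padded-length short = begin
      length padded                                    ≡⟨ length-++ R ⟩
      length R + length (replicate (5 ∸ length R) r₀)  ≡⟨ cong (length R +_) (length-replicate (5 ∸ length R)) ⟩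
      length R + (5 ∸ length R)                        ≡⟨ m+[n∸m]≡n (≤-pred (≤-pred short)) ⟩
      5                                                ∎
      where open ≡-Reasoning

  record Shape (R : List Row) : Set where
    field
      weight-balanced : ∀ i → Balanced (colWeight i R)
      distance-range  : ∀ i j → i ≢ j → ExtremeIn R i j ⊎ BalancedIn R i j
      extreme-K4      : ∃ (Pairwise4 (ExtremeIn R))
      no-balanced-K4  : ∀ q → ¬ Pairwise4 (BalancedIn R) q

  module SevenRows (r₀ : Row) (R : List Row) (covers : Covers2 (r₀ ∷ R)) (len : length (r₀ ∷ R) ≡ 7) where

    column : Fin 14 → Word
    column = normalColumn r₀ (r₀ ∷ R)

    column-normal : ∀ i → column i ∈ normalWords 6
    column-normal i = subst (λ n → column i ∈ normalWords n) (suc-injective len) (normalColumn-normal r₀ R i)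

    columns-independent : ∀ i j → i ≢ j → T (independent (column i) (column j))
    columns-independent = normalColumn-independent r₀ covers

    weight-eq : ∀ i → EqUpToComplement 7 (weight (column i)) (colWeight i (r₀ ∷ R))
    weight-eq i = subst (λ n → EqUpToComplement n (weight (column i)) (colWeight i (r₀ ∷ R))) len
                        (weight-normalColumn r₀ (r₀ ∷ R) i)

    distance-eq : ∀ i j → EqUpToComplement 7 (distance (column i) (column j)) (colDist i j (r₀ ∷ R))
    distance-eq i j = subst (λ n → EqUpToComplement n (distance (column i) (column j)) (colDist i j (r₀ ∷ R))) len
                            (distance-normalColumn r₀ (r₀ ∷ R) i j)

    shape-from-listing : (∃ λ xs → T (shape xs) × (∀ i → column i ∈ xs) ×
                                   (∀ {x} → x ∈ xs → ∃ λ i → column i ≡ x)) → Shape (r₀ ∷ R)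
    shape-from-listing (xs , shaped , column∈xs , members) = record
      { weight-balanced = λ i → oneOf-transfer (weight-eq i)
          (oneOf-sound (weight (column i))
            (All.lookup (all⁺ (oneOf? 3 4 ∘ weight) xs balanced-weights) (column∈xs i)))
      ; distance-range  = λ i j i≢j →
          Sum.map (oneOf-transfer (distance-eq i j)) (oneOf-transfer (distance-eq i j))
                  (independent-distance (column-normal i) (column-normal j) (columns-independent i j i≢j))
      ; extreme-K4      =
          let q , pairwise = K4-pullback column members (hasK4-sound extremePair xs (proj₁ K4-conditions))
          in q , pairwise4-map (λ {i} {j} t → oneOf-transfer (distance-eq i j) (oneOf-sound _ t)) q pairwise
      ; no-balanced-K4  = λ q pairwise → T-not (proj₂ K4-conditions) (hasK4-complete balancedPair xs
          (K4-image column column∈xs q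
            (pairwise4-map (λ {i} {j} b → oneOf-complete _ (oneOf-transfer⁻ (distance-eq i j) b)) q pairwise)))
      }
      where
      balanced-weights : T (all (oneOf? 3 4 ∘ weight) xs)
      balanced-weights = proj₁ (∧-elim shaped)
      K4-conditions : T (hasK4 extremePair xs) × T (not (hasK4 balancedPair xs))
      K4-conditions = ∧-elim (proj₂ (∧-elim {all (oneOf? 3 4 ∘ weight) xs} shaped))

  shape-of-7 : ∀ R → Covers2 R → length R ≡ 7 → Shape R
  shape-of-7 []       covers ()
  shape-of-7 (r₀ ∷ R) covers len = shape-from-listing
    (Search7.clique-listing {14} {normalWords 6} shape-of-14-independent-words-of-length-7
                            column columns-independent column-normal)
    where open SevenRows r₀ R covers len

Row15 : Set
Row15 = Fin 15 → Bool

Covers3 : List Row15 → Set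
Covers3 L = (cols : Fin 3 → Fin 15) → Injective _≡_ _≡_ cols → (v : Fin 3 → Bool) →
            Any (λ r → ∀ k → r (cols k) ≡ v k) L

triple : {A : Set} → A → A → A → Fin 3 → A
triple a b c zero             = a
triple a b c (suc zero)       = b
triple a b c (suc (suc zero)) = c

triple-injective : ∀ {c d e : Fin 15} → c ≢ d → c ≢ e → d ≢ e → Injective _≡_ _≡_ (triple c d e)
triple-injective _   _   _   {zero}           {zero}           _   = refl
triple-injective _   _   _   {suc zero}       {suc zero}       _   = refl
triple-injective _   _   _   {suc (suc zero)} {suc (suc zero)} _   = refl
triple-injective c≢d _   _   {zero}           {suc zero}       c≡d = ⊥-elim (c≢d c≡d)
triple-injective _   c≢e _   {zero}           {suc (suc zero)} c≡e = ⊥-elim (c≢e c≡e)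
triple-injective c≢d _   _   {suc zero}       {zero}           d≡c = ⊥-elim (c≢d (sym d≡c))
triple-injective _   _   d≢e {suc zero}       {suc (suc zero)} d≡e = ⊥-elim (d≢e d≡e)
triple-injective _   c≢e _   {suc (suc zero)} {zero}           e≡c = ⊥-elim (c≢e (sym e≡c))
triple-injective _   _   d≢e {suc (suc zero)} {suc zero}       e≡d = ⊥-elim (d≢e (sym e≡d))

ones zeros : Fin 15 → List Row15 → List Row15
ones  c = filterᵇ (λ r → r c)
zeros c = filterᵇ (not ∘ λ r → r c)

module Block (c : Fin 15) = TwoCovering (punchIn c)

-- Rows selected by their value in column c restrict to a 2-covering array
-- on the other columns: extend any two of them by c to three columns.
selected-covers : ∀ {L} → Covers3 L → ∀ c (select : Row15 → Bool) a → (∀ r → r c ≡ a → T (select r)) →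
                  Block.Covers2 c (filterᵇ select L)
selected-covers {L} covers c select a selects i j i≢j x y =
  any-filter select L (Any.map (λ hit → (hit (suc zero) , hit (suc (suc zero))) , selects _ (hit zero))
    (covers (triple c (punchIn c i) (punchIn c j))
            (triple-injective (Fin.punchInᵢ≢i c i ∘ sym) (Fin.punchInᵢ≢i c j ∘ sym)
                              (i≢j ∘ Fin.punchIn-injective c i j))
            (triple a x y)))

squeeze : ∀ {a b} → a + b ≤ 14 → 7 ≤ a → 7 ≤ b → a ≡ 7 × b ≡ 7
squeeze {a} {b} sum≤14 7≤a 7≤b =
  ≤-antisym (+-cancelʳ-≤ 7 a 7 (≤-trans (+-monoʳ-≤ a 7≤b) sum≤14)) 7≤a ,
  ≤-antisym (+-cancelˡ-≤ 7 b 7 (≤-trans (+-monoˡ-≤ b 7≤a) sum≤14)) 7≤b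

module SmallArray (L : List Row15) (covers : Covers3 L) (small : length L ≤ 14) where

  ones-covers : ∀ c → Block.Covers2 c (ones c L)
  ones-covers c = selected-covers covers c (λ r → r c) true (λ r rc≡1 → subst T (sym rc≡1) tt)

  zeros-covers : ∀ c → Block.Covers2 c (zeros c L)
  zeros-covers c =
    selected-covers covers c (not ∘ λ r → r c) false (λ r rc≡0 → subst (T ∘ not) (sym rc≡0) tt)

  -- Both derived arrays have at least 7 rows and together at most 14.
  derived-length : ∀ c → length (ones c L) ≡ 7 × length (zeros c L) ≡ 7
  derived-length c = squeeze (subst (_≤ 14) (length-split (λ r → r c) L) small)
                             (Block.covers2-length c _ (ones-covers c)) (Block.covers2-length c _ (zeros-covers c))

  ones-shape : ∀ c → Block.Shape c (ones c L)
  ones-shape c = Block.shape-of-7 c _ (ones-covers c) (proj₁ (derived-length c))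

  zeros-shape : ∀ c → Block.Shape c (zeros c L)
  zeros-shape c = Block.shape-of-7 c _ (zeros-covers c) (proj₂ (derived-length c))

  -- Rows where columns d and e differ: those with (d, e) = (1, 0) are as
  -- many as those with (d, e) = (0, 1), since ones d L and ones e L both
  -- have 7 rows.  So their number is twice the weight of e in zeros d L.
  differ-twice : ∀ d e → count (λ r → r d xor r e) L ≡
                         count (λ r → r e) (zeros d L) + count (λ r → r e) (zeros d L)
  differ-twice d e = begin
      count differ L
    ≡⟨ count-split differ (λ r → r d) L ⟩
      count differ (ones d L) + count differ (zeros d L)
    ≡⟨ cong₂ _+_ on-ones on-zeros ⟩
      count (not ∘ at-e) (ones d L) + w
    ≡⟨ cong (_+ w) one-zero≡zero-one ⟩
      w + w
    ∎
    where
    open ≡-Reasoning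
    differ at-e : Row15 → Bool
    differ r = r d xor r e
    at-e   r = r e
    w : ℕ
    w = count at-e (zeros d L)
    on-ones : count differ (ones d L) ≡ count (not ∘ at-e) (ones d L)
    on-ones = count-cong (ones d L) λ {r} r∈ →
      cong (_xor r e) (Equivalence.to T-≡ (proj₂ (∈-filter⁻ (T? ∘ λ r → r d) {xs = L} r∈)))
    on-zeros : count differ (zeros d L) ≡ w
    on-zeros = count-cong (zeros d L) λ {r} r∈ →
      cong (_xor r e) (Equivalence.to T-not-≡ (proj₂ (∈-filter⁻ (T? ∘ not ∘ λ r → r d) {xs = L} r∈)))
    one-zero≡zero-one : count (not ∘ at-e) (ones d L) ≡ w
    one-zero≡zero-one = +-cancelʳ-≡ (count at-e (ones d L)) _ _ (begin
        count (not ∘ at-e) (ones d L) + count at-e (ones d L)  ≡⟨ count-complement at-e (ones d L) ⟩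
        length (ones d L)                                     ≡⟨ proj₁ (derived-length d) ⟩
        7                                                     ≡⟨ proj₁ (derived-length e) ⟨
        count at-e L                                          ≡⟨ count-split at-e (λ r → r d) L ⟩
        count at-e (ones d L) + w                             ≡⟨ +-comm (count at-e (ones d L)) w ⟩
        w + count at-e (ones d L)                             ∎)

  -- Hence two columns are never at extreme distance in both derived
  -- arrays of a third column c: the distances would add up to 4, 7 or 10,
  -- while twice a balanced weight is 6 or 8.
  not-extreme-in-both : ∀ c {p q} → Block.ExtremeIn c (ones c L) p q →
                        Block.ExtremeIn c (zeros c L) p q → ⊥
  not-extreme-in-both c {p} {q} extreme-ones extreme-zeros =
    extreme+extreme≢balanced+balanced extreme-ones extreme-zeros weight-balanced
      (trans (sym (count-split (λ r → r d xor r e) (λ r → r c) L)) (differ-twice d e))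
    where
    d e : Fin 15
    d = punchIn c p
    e = punchIn c q
    d≢e : d ≢ e
    d≢e = Block.extreme-distinct c (ones c L) extreme-ones ∘ Fin.punchIn-injective c p q
    weight-balanced : Balanced (count (λ r → r e) (zeros d L))
    weight-balanced = subst (λ k → Balanced (count (λ r → r k) (zeros d L))) (Fin.punchIn-punchOut d≢e)
                            (Block.Shape.weight-balanced (zeros-shape d) (punchOut d≢e))

  -- Four columns pairwise at extreme distance in zeros 0 L would be pairwise
  -- at balanced distance in ones 0 L, which has no such four columns.
  no-small-array : ⊥
  no-small-array =
    let q , extreme-in-zeros = Zeros.extreme-K4
    in Ones.no-balanced-K4 q
         (pairwise4-map {_~_ = Block.ExtremeIn zero (zeros zero L)} balanced-in-ones q extreme-in-zeros)
    where
    module Ones  = Block.Shape zero (ones-shape zero)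
    module Zeros = Block.Shape zero (zeros-shape zero)
    balanced-in-ones : ∀ {p q} → Block.ExtremeIn zero (zeros zero L) p q →
                       Block.BalancedIn zero (ones zero L) p q
    balanced-in-ones {p} {q} extreme
      with Ones.distance-range p q (Block.extreme-distinct zero (zeros zero L) extreme)
    ... | inj₁ extreme-ones = ⊥-elim (not-extreme-in-both zero extreme-ones extreme)
    ... | inj₂ balanced     = balanced

lemma4p6 : CAN≥ 3 15 15
lemma4p6 m A covering = ≮⇒≥ λ m<15 →
  SmallArray.no-small-array (tabulate A) rows-cover (subst (_≤ 14) (sym (length-tabulate A)) (≤-pred m<15))
  where
  rows-cover : Covers3 (tabulate A)
  rows-cover cols injective v = let r , hit = covering cols injective v in Any.tabulate⁺ r hit
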